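{- Let $G$ be a graph of modular width at most $w$. Then every shortest path in $G$ has length at most $w$. Moreover, if $|V(G)|>w$ and $V_1,\dots,V_r$ (with $r\le w$) is a partition of $V(G)$ into modules of $G$ such that each $G[V_i]$ has modular width at most $w$, then every shortest path in $G$ of length at least three is either fully contained in some $G[V_i]$ or contains at most one vertex from each $V_i$, $i\in[r]$.
   Context: Graphs are finite, simple, undirected and unweighted; the length of a path is its number of edges. A module of $G$ is a set $M\subseteq V(G)$ such that for all $u,v\in M$ and $x\in V(G)\setminus M$, $ux\in E(G)$ implies $vx\in E(G)$. $G$ has modular width at most $w$ if either $|V(G)|\le w$, or there is a partition of $V(G)$ into at most $w$ sets $V_1,\dots,V_r$ such that each $V_i$ is a module of $G$ and each $G[V_i]$ has modular width at most $w$ (an inductive definition). -}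

module Defs where

open import Data.Nat using (ℕ; zero; suc; _≤_; _<_)
import Data.Fin
open import Data.Fin using (Fin; inject₁) renaming (suc to fsuc)
open import Data.Fin.Subset using (Subset; _∈_; _∉_; _⊆_; ⊤; ∣_∣; Nonempty)
open import Data.Product using (Σ; ∃; _×_; _,_)
open import Relation.Binary.PropositionalEquality using (_≡_)
open import Relation.Nullary using (¬_)
open import Level using (0ℓ)

record Graph (n : ℕ) : Set₁ where
  field
    E      : Fin n → Fin n → Set
    sym    : ∀ {u v} → E u v → E v u
    irrefl : ∀ {u} → ¬ E u u
open Graph public

module _ {n : ℕ} (G : Graph n) where

  IsModuleIn : Subset n → Subset n → Set
  IsModuleIn S M =
    M ⊆ S ×
    (∀ u v x → u ∈ M → v ∈ M → x ∈ S → x ∉ M → E G u x → E G v x)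

  IsModulePartition : Subset n → (r : ℕ) → (Fin r → Subset n) → Set
  IsModulePartition S r V =
    (∀ i → Nonempty (V i)) ×
    (∀ i → IsModuleIn S (V i)) ×
    (∀ x → x ∈ S → ∃ λ i → x ∈ V i) ×
    (∀ i j x → x ∈ V i → x ∈ V j → i ≡ j)

  data MW (w : ℕ) : Subset n → Set where
    small : ∀ {S} → ∣ S ∣ ≤ w → MW w S
    split : ∀ {S} (r : ℕ) (V : Fin r → Subset n) → r ≤ w →
            IsModulePartition S r V → (∀ i → MW w (V i)) → MW w S

  IsPath : (k : ℕ) → (Fin (suc k) → Fin n) → Set
  IsPath k P =
    (∀ i j → P i ≡ P j → i ≡ j) ×
    (∀ (i : Fin k) → E G (P (inject₁ i)) (P (fsuc i)))

  IsShortestPath : (k : ℕ) → (Fin (suc k) → Fin n) → Set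
  IsShortestPath k P =
    IsPath k P ×
    (∀ (m : ℕ) (Q : Fin (suc m) → Fin n) → IsPath m Q →
       Q Data.Fin.zero ≡ P Data.Fin.zero → Q (Data.Fin.fromℕ m) ≡ P (Data.Fin.fromℕ k) → k ≤ m)

-- A shortest path has no chords, so two of its vertices are adjacent in G only
-- if they are consecutive on the path. If the path meets a module M and leaves
-- it, some vertex x off M is adjacent to a vertex of M, hence to every vertex of
-- the path in M, which therefore all sit right next to x: at most two of them, at
-- positions x − 1 and x + 1. With length at least three the path continues past
-- one of them, and the next vertex z contradicts chordlessness whether or not it
-- lies in M. So a shortest path either stays inside one block of a modular
-- partition (where induction applies) or meets every block at most once, giving
-- at most r ≤ w vertices; paths of length at most two need just two blocks.
module Submission where

open import Defs hiding (sym)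
open import Data.Nat using (ℕ; zero; suc; _+_; _∸_; _≤_; _<_; z≤n; s≤s; _≤?_)
open import Data.Nat.Properties
open import Data.Fin using (Fin; toℕ; fromℕ; fromℕ<; inject₁) renaming (zero to fz; suc to fs)
open import Data.Fin.Properties
  using (toℕ-injective; toℕ-fromℕ<; toℕ-fromℕ; toℕ-inject₁; toℕ<n; all?; ¬∀⟶∃¬; injective⇒≤)
  renaming (_≟_ to _≟ᶠ_; suc-injective to fs-injective)
open import Data.Fin.Subset using (Subset; _∈_; _∉_; _⊆_; ⊤; ∣_∣; inside; outside)
open import Data.Fin.Subset.Properties using (_∈?_; ∈⊤)
open import Data.Vec.Base using (_∷_; here; there)
open import Data.Product using (∃; ∃₂; _×_; _,_; proj₁; proj₂)
open import Data.Sum using (_⊎_; inj₁; inj₂; map₂; swap)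
open import Data.Empty using (⊥; ⊥-elim)
open import Function using (_∘_)
open import Level using (Level)
open import Relation.Nullary using (¬_; ¬?; yes; no)
open import Relation.Nullary.Decidable using (decidable-stable)
open import Relation.Unary using (Pred; Decidable)
open import Relation.Binary using (tri<; tri≈; tri>)
open import Relation.Binary.PropositionalEquality

private
  variable
    ℓ : Level
    a b c d k m n r w : ℕ

data Consecutive : ℕ → ℕ → Set where
  up   : Consecutive m (suc m)
  down : Consecutive (suc m) m

Consecutive-sym : Consecutive a b → Consecutive b a
Consecutive-sym up   = down
Consecutive-sym down = up

¬Consecutive-triangle : Consecutive a b → Consecutive b c → ¬ Consecutive a c
¬Consecutive-triangle up   up   ()
¬Consecutive-triangle up   down ()
¬Consecutive-triangle down up   ()
¬Consecutive-triangle down down ()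

Consecutive-midpoint-unique : Consecutive a b → Consecutive b c → a ≢ c →
                              Consecutive a d → Consecutive d c → b ≡ d
Consecutive-midpoint-unique up   up   _   up   _  = refl
Consecutive-midpoint-unique up   up   _   down ()
Consecutive-midpoint-unique up   down a≢c _    _  = ⊥-elim (a≢c refl)
Consecutive-midpoint-unique down up   a≢c _    _  = ⊥-elim (a≢c refl)
Consecutive-midpoint-unique down down _   up   ()
Consecutive-midpoint-unique down down _   down _  = refl

Consecutive-extend : ∀ {u x v} → u ≤ k → v ≤ k → 3 ≤ k →
                     Consecutive u x → Consecutive x v → u ≢ v →
                     ∃ λ z → z ≤ k × (Consecutive z u ⊎ Consecutive z v) × z ≢ x
Consecutive-extend {u = u} _ v≤k 3≤k up up _ with m≤n⇒m<n∨m≡n v≤k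
... | inj₁ v<k = suc (suc (suc u)) , v<k , inj₂ down , λ ()
Consecutive-extend {u = zero}  _   _ (s≤s (s≤s ())) up up _ | inj₂ refl
Consecutive-extend {u = suc z} u≤k _ _              up up _ | inj₂ refl =
  z , ≤-trans (n≤1+n z) u≤k , inj₁ up , λ ()
Consecutive-extend _   _   _   up   down u≢v = ⊥-elim (u≢v refl)
Consecutive-extend _   _   _   down up   u≢v = ⊥-elim (u≢v refl)
Consecutive-extend u≤k v≤k 3≤k down down u≢v
  with Consecutive-extend v≤k u≤k 3≤k up up (≢-sym u≢v)
... | z , z≤k , z-adj , z≢x = z , z≤k , swap z-adj , z≢x

-- skip a d j = j for j ≤ a and j + d for j > a: it jumps over the d numbers after a.
skip : ℕ → ℕ → ℕ → ℕ
skip _       _ zero    = zero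
skip zero    d (suc j) = suc (j + d)
skip (suc a) d (suc j) = suc (skip a d j)

skip-≤ : ∀ a d j → skip a d j ≤ j + d
skip-≤ _       _ zero    = z≤n
skip-≤ zero    _ (suc _) = ≤-refl
skip-≤ (suc a) d (suc j) = s≤s (skip-≤ a d j)

skip-injective : ∀ a d i j → skip a d i ≡ skip a d j → i ≡ j
skip-injective _       _ zero    zero    _  = refl
skip-injective zero    _ zero    (suc _) ()
skip-injective (suc _) _ zero    (suc _) ()
skip-injective zero    _ (suc _) zero    ()
skip-injective (suc _) _ (suc _) zero    ()
skip-injective zero    d (suc i) (suc j) eq = cong suc (+-cancelʳ-≡ d i j (suc-injective eq))
skip-injective (suc a) d (suc i) (suc j) eq = cong suc (skip-injective a d i j (suc-injective eq))

skip-self : ∀ a d → skip a d a ≡ a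
skip-self zero    _ = refl
skip-self (suc a) d = cong suc (skip-self a d)

skip-> : ∀ a d j → a < j → skip a d j ≡ j + d
skip-> zero    _ (suc _) _         = refl
skip-> (suc a) d (suc j) (s≤s a<j) = cong suc (skip-> a d j a<j)

skip-suc : ∀ a d j → j ≢ a → skip a d (suc j) ≡ suc (skip a d j)
skip-suc zero    _ zero    j≢a = ⊥-elim (j≢a refl)
skip-suc zero    _ (suc _) _   = refl
skip-suc (suc a) _ zero    _   = refl
skip-suc (suc a) d (suc j) j≢a = cong suc (skip-suc a d j (j≢a ∘ cong suc))

first-exit : {R : Pred (Fin (suc k)) ℓ} → Decidable R → R fz → ∀ {j} → ¬ R j →
             ∃ λ (t : Fin k) → R (inject₁ t) × ¬ R (fs t)
first-exit R? R₀ {fz} ¬Rj = ⊥-elim (¬Rj R₀)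
first-exit {k = suc _} R? R₀ {fs j} ¬Rj with R? (inject₁ j)
... | yes Rj′ = j , Rj′ , ¬Rj
... | no ¬Rj′ with first-exit (R? ∘ inject₁) R₀ ¬Rj′
...   | t , exit = inject₁ t , exit

position : (p : Subset n) {x : Fin n} → x ∈ p → Fin ∣ p ∣
position (inside  ∷ p) here        = fz
position (inside  ∷ p) (there x∈p) = fs (position p x∈p)
position (outside ∷ p) (there x∈p) = position p x∈p

position-injective : (p : Subset n) {x y : Fin n} (x∈p : x ∈ p) (y∈p : y ∈ p) →
                     position p x∈p ≡ position p y∈p → x ≡ y
position-injective (inside  ∷ p) here        here        _  = refl
position-injective (inside  ∷ p) (there x∈p) (there y∈p) eq =
  cong fs (position-injective p x∈p y∈p (fs-injective eq))
position-injective (outside ∷ p) (there x∈p) (there y∈p) eq =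
  cong fs (position-injective p x∈p y∈p eq)

injective⇒≤∣p∣ : {p : Subset n} {f : Fin m → Fin n} →
                 (∀ i j → f i ≡ f j → i ≡ j) → (∀ i → f i ∈ p) → m ≤ ∣ p ∣
injective⇒≤∣p∣ {p = p} f-inj f∈p =
  injective⇒≤ λ {i} {j} eq → f-inj i j (position-injective p (f∈p i) (f∈p j) eq)

distinct⇒2≤ : {i j : Fin r} → i ≢ j → 2 ≤ r
distinct⇒2≤ {suc zero}    {fz} {fz} i≢j = ⊥-elim (i≢j refl)
distinct⇒2≤ {suc (suc _)} _             = s≤s (s≤s z≤n)

module _ {n : ℕ} (G : Graph n) where

  private
    variable
      P : Fin (suc k) → Fin n
      S M : Subset n
      V : Fin r → Subset n

  step-edge : (∀ (t : Fin k) → E G (P (inject₁ t)) (P (fs t))) →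
              ∀ i j → suc (toℕ i) ≡ toℕ j → E G (P i) (P j)
  step-edge {suc _} edges fz     (fs fz)     _  = edges fz
  step-edge {suc _} {P} edges (fs i) (fs j) eq =
    step-edge {P = P ∘ fs} (λ t → edges (fs t)) i j (suc-injective eq)
  step-edge {suc _} edges fz     (fs (fs _)) ()

  Consecutive⇒edge : IsPath G k P → ∀ i j → Consecutive (toℕ i) (toℕ j) → E G (P i) (P j)
  Consecutive⇒edge {P = P} (_ , edges) i j i~j = edge i~j refl refl
    where
    edge : Consecutive a b → toℕ i ≡ a → toℕ j ≡ b → E G (P i) (P j)
    edge up   refl j≡ = step-edge {P = P} edges i j (sym j≡)
    edge down i≡ refl = Graph.sym G (step-edge {P = P} edges j i (sym i≡))

  boundary-edge : IsPath G k P → ∀ {i c} → P i ∈ M → P c ∉ M →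
                  ∃₂ λ y x → P y ∈ M × P x ∉ M × E G (P y) (P x)
  boundary-edge {P = P} {M = M} (_ , edges) Pi∈M Pc∉M with P fz ∈? M
  ... | yes P₀∈M with first-exit (λ j → P j ∈? M) P₀∈M Pc∉M
  ...   | t , entered , left = inject₁ t , fs t , entered , left , edges t
  boundary-edge {P = P} {M = M} (_ , edges) Pi∈M Pc∉M | no P₀∉M
    with first-exit (λ j → ¬? (P j ∈? M)) P₀∉M (λ Pi∉M → Pi∉M Pi∈M)
  ... | t , left , entered =
    fs t , inject₁ t , decidable-stable (P (fs t) ∈? M) entered , left , Graph.sym G (edges t)

  -- f follows P up to a, jumps along the edge ab and follows P again from b,
  -- skipping the d vertices in between.
  shortcut : IsPath G k P → m + d ≡ k → ∀ a b → toℕ b ≡ suc (toℕ a + d) →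
             E G (P a) (P b) →
             ∃ λ (f : Fin (suc m) → Fin (suc k)) →
               IsPath G m (P ∘ f) × f fz ≡ fz × f (fromℕ m) ≡ fromℕ k
  shortcut {k = k} {P = P} {m = m} {d = d} (P-injective , edges) m+d≡k a b b≡ ab =
    f , (f-injective , f-edges) , toℕ-injective (toℕ-f fz) , toℕ-injective f-last
    where
    A = toℕ a
    f : Fin (suc m) → Fin (suc k)
    f j = fromℕ< (s≤s (≤-trans (skip-≤ A d (toℕ j))
                   (subst (toℕ j + d ≤_) m+d≡k (+-monoˡ-≤ d (≤-pred (toℕ<n j))))))
    toℕ-f : ∀ j → toℕ (f j) ≡ skip A d (toℕ j)
    toℕ-f j = toℕ-fromℕ< _
    f-injective : ∀ i j → P (f i) ≡ P (f j) → i ≡ j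
    f-injective i j eq = toℕ-injective (skip-injective A d _ _
      (trans (sym (toℕ-f i)) (trans (cong toℕ (P-injective _ _ eq)) (toℕ-f j))))
    f-edges : ∀ (t : Fin m) → E G (P (f (inject₁ t))) (P (f (fs t)))
    f-edges t with toℕ t ≟ A
    ... | yes t≡A = subst₂ (λ u v → E G (P u) (P v)) (sym fa) (sym fb) ab
      where
      fa : f (inject₁ t) ≡ a
      fa = toℕ-injective (begin
        toℕ (f (inject₁ t))        ≡⟨ toℕ-f (inject₁ t) ⟩
        skip A d (toℕ (inject₁ t)) ≡⟨ cong (skip A d) (trans (toℕ-inject₁ t) t≡A) ⟩
        skip A d A                 ≡⟨ skip-self A d ⟩
        A                          ∎)
        where open ≡-Reasoning
      fb : f (fs t) ≡ b
      fb = toℕ-injective (begin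
        toℕ (f (fs t))           ≡⟨ toℕ-f (fs t) ⟩
        skip A d (suc (toℕ t))   ≡⟨ cong (skip A d ∘ suc) t≡A ⟩
        skip A d (suc A)         ≡⟨ skip-> A d (suc A) ≤-refl ⟩
        suc (A + d)              ≡⟨ sym b≡ ⟩
        toℕ b                    ∎)
        where open ≡-Reasoning
    ... | no t≢A = step-edge {P = P} edges _ _ (begin
        suc (toℕ (f (inject₁ t)))        ≡⟨ cong suc (toℕ-f (inject₁ t)) ⟩
        suc (skip A d (toℕ (inject₁ t))) ≡⟨ cong (suc ∘ skip A d) (toℕ-inject₁ t) ⟩
        suc (skip A d (toℕ t))           ≡⟨ sym (skip-suc A d (toℕ t) t≢A) ⟩
        skip A d (suc (toℕ t))           ≡⟨ sym (toℕ-f (fs t)) ⟩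
        toℕ (f (fs t))                   ∎)
      where open ≡-Reasoning
    A<m : A < m
    A<m = +-cancelʳ-≤ d (suc A) m
            (subst₂ _≤_ b≡ (sym m+d≡k) (≤-pred (toℕ<n b)))
    f-last : toℕ (f (fromℕ m)) ≡ toℕ (fromℕ k)
    f-last = begin
      toℕ (f (fromℕ m))          ≡⟨ toℕ-f (fromℕ m) ⟩
      skip A d (toℕ (fromℕ m))   ≡⟨ cong (skip A d) (toℕ-fromℕ m) ⟩
      skip A d m                 ≡⟨ skip-> A d m A<m ⟩
      m + d                      ≡⟨ m+d≡k ⟩
      k                          ≡⟨ sym (toℕ-fromℕ k) ⟩
      toℕ (fromℕ k)              ∎
      where open ≡-Reasoning

  record IsShortestPathIn (S : Subset n) (k : ℕ) (P : Fin (suc k) → Fin n) : Set where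
    field
      isPath  : IsPath G k P
      within  : ∀ j → P j ∈ S
      minimal : ∀ m (Q : Fin (suc m) → Fin n) → IsPath G m Q → (∀ j → Q j ∈ S) →
                Q fz ≡ P fz → Q (fromℕ m) ≡ P (fromℕ k) → k ≤ m
  open IsShortestPathIn

  IsShortestPath⇒IsShortestPathIn⊤ : IsShortestPath G k P → IsShortestPathIn ⊤ k P
  IsShortestPath⇒IsShortestPathIn⊤ (path , min) = record
    { isPath = path ; within = λ _ → ∈⊤ ; minimal = λ m Q Q-path _ → min m Q Q-path }

  IsShortestPathIn-restrict : {T : Subset n} → IsShortestPathIn S k P →
                              (∀ j → P j ∈ T) → T ⊆ S → IsShortestPathIn T k P
  IsShortestPathIn-restrict sp P∈T T⊆S = record
    { isPath  = isPath sp
    ; within  = P∈T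
    ; minimal = λ m Q Q-path Q∈T → minimal sp m Q Q-path (T⊆S ∘ Q∈T)
    }

  ¬long-chord : IsShortestPathIn S k P → ∀ i j → suc (suc (toℕ i)) ≤ toℕ j →
                ¬ E G (P i) (P j)
  ¬long-chord {k = k} {P = P} sp i j i+2≤j ij
    with m≤n⇒∃[o]m+o≡n i+2≤j
  ... | o , i+2+o≡j = <⇒≱ (∸-monoʳ-< {o = 0} (s≤s z≤n) gap≤k) k≤k∸gap
    where
    gap = suc o
    j≡ : toℕ j ≡ suc (toℕ i + gap)
    j≡ = trans (sym i+2+o≡j) (cong suc (sym (+-suc (toℕ i) o)))
    gap≤k : gap ≤ k
    gap≤k = ≤-trans (m≤n+m gap (suc (toℕ i)))
              (≤-trans (≤-reflexive (sym j≡)) (≤-pred (toℕ<n j)))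
    k≤k∸gap : k ≤ k ∸ gap
    k≤k∸gap with shortcut (isPath sp) (m∸n+n≡m gap≤k) i j j≡ ij
    ... | f , Q-path , f₀ , f-last =
      minimal sp _ (P ∘ f) Q-path (within sp ∘ f) (cong P f₀) (cong P f-last)

  chordless-< : IsShortestPathIn S k P → ∀ i j → toℕ i < toℕ j → E G (P i) (P j) →
                Consecutive (toℕ i) (toℕ j)
  chordless-< sp i j i<j ij with m≤n⇒m<n∨m≡n i<j
  ... | inj₁ i+1<j = ⊥-elim (¬long-chord sp i j i+1<j ij)
  ... | inj₂ i+1≡j = subst (Consecutive (toℕ i)) i+1≡j up

  chordless : IsShortestPathIn S k P → ∀ i j → E G (P i) (P j) →
              Consecutive (toℕ i) (toℕ j)
  chordless {P = P} sp i j ij with <-cmp (toℕ i) (toℕ j)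
  ... | tri< i<j _ _ = chordless-< sp i j i<j ij
  ... | tri> _ _ j<i = Consecutive-sym (chordless-< sp j i j<i (Graph.sym G ij))
  ... | tri≈ _ i≡j _ =
    ⊥-elim (irrefl G (subst (E G (P i) ∘ P) (sym (toℕ-injective i≡j)) ij))

  module _ (sp : IsShortestPathIn S k P) (M-module : IsModuleIn G S M) where

    attached⇒Consecutive : ∀ {y x z} → P y ∈ M → P x ∉ M → E G (P y) (P x) →
                           P z ∈ M → Consecutive (toℕ z) (toℕ x)
    attached⇒Consecutive {y} {x} {z} Py∈M Px∉M yx Pz∈M =
      chordless sp z x (proj₂ M-module (P y) (P z) (P x) Py∈M Pz∈M (within sp x) Px∉M yx)

    ¬sandwich : ∀ {u x v z} → P u ∈ M → P v ∈ M → P x ∉ M →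
                Consecutive (toℕ u) (toℕ x) → Consecutive (toℕ x) (toℕ v) → toℕ u ≢ toℕ v →
                Consecutive (toℕ z) (toℕ v) → toℕ z ≢ toℕ x → ⊥
    ¬sandwich {u} {x} {v} {z} Pu∈M Pv∈M Px∉M u~x x~v u≢v z~v z≢x with P z ∈? M
    ... | yes Pz∈M = ¬Consecutive-triangle z~v (Consecutive-sym x~v)
                       (attached⇒Consecutive Pu∈M Px∉M (Consecutive⇒edge (isPath sp) u x u~x) Pz∈M)
    ... | no Pz∉M = z≢x (sym (Consecutive-midpoint-unique u~x x~v u≢v u~z z~v))
      where
      u~z = attached⇒Consecutive Pv∈M Pz∉M
              (Consecutive⇒edge (isPath sp) v z (Consecutive-sym z~v)) Pu∈M

    ¬two-neighbours-in-module : 3 ≤ k → ∀ {i j x} → P i ∈ M → P j ∈ M → P x ∉ M →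
                                Consecutive (toℕ i) (toℕ x) → Consecutive (toℕ j) (toℕ x) →
                                toℕ i ≢ toℕ j → ⊥
    ¬two-neighbours-in-module 3≤k {i} {j} Pi∈M Pj∈M Px∉M i~x j~x i≢j
      with Consecutive-extend (≤-pred (toℕ<n i)) (≤-pred (toℕ<n j)) 3≤k
             i~x (Consecutive-sym j~x) i≢j
    ... | z , z≤k , z-adjacent , z≢x
      with fromℕ< (s≤s z≤k) | toℕ-fromℕ< (s≤s z≤k) | z-adjacent
    ...   | ẑ | refl | inj₁ z~i =
      ¬sandwich {z = ẑ} Pj∈M Pi∈M Px∉M j~x (Consecutive-sym i~x) (≢-sym i≢j) z~i z≢x
    ...   | ẑ | refl | inj₂ z~j =
      ¬sandwich {z = ẑ} Pi∈M Pj∈M Px∉M i~x (Consecutive-sym j~x) i≢j z~j z≢x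

    meets-module-at-most-once : 3 ≤ k → ∀ {c} → P c ∉ M →
                                ∀ i j → P i ∈ M → P j ∈ M → i ≡ j
    meets-module-at-most-once 3≤k Pc∉M i j Pi∈M Pj∈M
      with boundary-edge (isPath sp) Pi∈M Pc∉M
    ... | y , x , Py∈M , Px∉M , yx with toℕ i ≟ toℕ j
    ...   | yes i≡j = toℕ-injective i≡j
    ...   | no i≢j =
      ⊥-elim (¬two-neighbours-in-module 3≤k Pi∈M Pj∈M Px∉M (near Pi∈M) (near Pj∈M) i≢j)
      where
      near : ∀ {z} → P z ∈ M → Consecutive (toℕ z) (toℕ x)
      near = attached⇒Consecutive Py∈M Px∉M yx

  inside-block⊎leaves-blocks : IsModulePartition G S r V → (∀ j → P j ∈ S) →
                               (∃ λ i → ∀ j → P j ∈ V i) ⊎ (∀ i → ∃ λ c → P c ∉ V i)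
  inside-block⊎leaves-blocks {V = V} {P = P} (_ , _ , cover , disjoint) P∈S
    with cover (P fz) (P∈S fz)
  ... | i₀ , P₀∈Vi₀ with all? (λ j → P j ∈? V i₀)
  ...   | yes inside-i₀ = inj₁ (i₀ , inside-i₀)
  ...   | no ¬inside-i₀ = inj₂ leaves
    where
    leaves : ∀ i → ∃ λ c → P c ∉ V i
    leaves i with i ≟ᶠ i₀
    ... | yes refl = ¬∀⟶∃¬ _ _ (λ j → P j ∈? V i₀) ¬inside-i₀
    ... | no i≢i₀  = fz , λ P₀∈Vi → i≢i₀ (disjoint i i₀ (P fz) P₀∈Vi P₀∈Vi₀)

  leaves-blocks⇒2≤r : IsModulePartition G S r V → (∀ j → P j ∈ S) →
                      (∀ i → ∃ λ c → P c ∉ V i) → 2 ≤ r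
  leaves-blocks⇒2≤r {P = P} (_ , _ , cover , _) P∈S leaves with cover (P fz) (P∈S fz)
  ... | i₀ , _ with leaves i₀
  ...   | c , Pc∉Vi₀ with cover (P c) (P∈S c)
  ...     | i₁ , Pc∈Vi₁ = distinct⇒2≤ {i = i₀} {j = i₁} λ { refl → Pc∉Vi₀ Pc∈Vi₁ }

  leaves-blocks⇒meets-blocks-once : IsModulePartition G S r V → IsShortestPathIn S k P →
                                    3 ≤ k → (∀ i → ∃ λ c → P c ∉ V i) →
                                    ∀ i j j′ → P j ∈ V i → P j′ ∈ V i → j ≡ j′
  leaves-blocks⇒meets-blocks-once (_ , modules , _) sp 3≤k leaves i =
    meets-module-at-most-once sp (modules i) 3≤k (proj₂ (leaves i))

  meets-blocks-once⇒length<r : {P : Fin (suc k) → Fin n} →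
                               IsModulePartition G S r V → (∀ j → P j ∈ S) →
                               (∀ i j j′ → P j ∈ V i → P j′ ∈ V i → j ≡ j′) → k < r
  meets-blocks-once⇒length<r {k = k} {r = r} {V = V} {P = P} (_ , _ , cover , _) P∈S once =
    injective⇒≤ {f = block} λ {j} {j′} block-j≡block-j′ →
      once (block j′) j j′ (subst (λ i → P j ∈ V i) block-j≡block-j′ (∈block j)) (∈block j′)
    where
    block : Fin (suc k) → Fin r
    block j = proj₁ (cover (P j) (P∈S j))
    ∈block : ∀ j → P j ∈ V (block j)
    ∈block j = proj₂ (cover (P j) (P∈S j))

  length≤width : MW G w S → IsShortestPathIn S k P → k ≤ w
  length≤width (small ∣S∣≤w) sp =
    ≤-trans (<⇒≤ (injective⇒≤∣p∣ (proj₁ (isPath sp)) (within sp))) ∣S∣≤w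
  length≤width {k = k} (split r V r≤w partition widths) sp
    with inside-block⊎leaves-blocks partition (within sp)
  ... | inj₁ (i , P∈Vi) =
    length≤width (widths i) (IsShortestPathIn-restrict sp P∈Vi (proj₁ (proj₁ (proj₂ partition) i)))
  ... | inj₂ leaves with 3 ≤? k
  ...   | no k<3  =
    ≤-trans (≤-pred (≰⇒> k<3)) (≤-trans (leaves-blocks⇒2≤r partition (within sp) leaves) r≤w)
  ...   | yes 3≤k = ≤-trans (<⇒≤ (meets-blocks-once⇒length<r partition (within sp)
                      (leaves-blocks⇒meets-blocks-once partition sp 3≤k leaves))) r≤w

proposition2 : ∀ {n : ℕ} (G : Graph n) (w : ℕ) → MW G w ⊤ →
    (∀ (k : ℕ) (P : Fin (suc k) → Fin n) → IsShortestPath G k P → k ≤ w)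
    ×
    (w < n → ∀ (r : ℕ) (V : Fin r → Subset n) → r ≤ w →
      IsModulePartition G ⊤ r V → (∀ i → MW G w (V i)) →
      ∀ (k : ℕ) (P : Fin (suc k) → Fin n) → IsShortestPath G k P → 3 ≤ k →
        (∃ λ i → ∀ j → P j ∈ V i)
        ⊎
        (∀ i j j′ → P j ∈ V i → P j′ ∈ V i → j ≡ j′))
proposition2 G w width =
  (λ k P shortest → length≤width G width (IsShortestPath⇒IsShortestPathIn⊤ G shortest)) ,
  λ _ r V _ partition _ k P shortest 3≤k →
    map₂ (leaves-blocks⇒meets-blocks-once G partition
            (IsShortestPath⇒IsShortestPathIn⊤ G shortest) 3≤k)
         (inside-block⊎leaves-blocks G partition (λ _ → ∈⊤))
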